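{- Let $\mathcal S=(n,I,J,K,\psi,\pi)$ be a system and let $(y_i)_{i=0}^n$ be a sequence admissible for $\mathcal S$. Let $k\ge2$ and $t\ge-1$ be integers with $k+t\le n$ such that all indices $k,k+1,\dots,k+t$ are ordinary. Then $y_{k+t}=F(t+1)y_{k-1}+F(t)y_{k-2}$.
   Context: The Fibonacci numbers are defined by $F(0)=F(1)=1$ and $F(m+1)=F(m)+F(m-1)$ for all integers $m$ (so $F(-1)=0$). A system is a tuple $\mathcal S=(n,I,J,K,\psi,\pi)$ where $n\ge2$ is an integer, $I,J,K$ are pairwise disjoint subsets of $\{2,\dots,n\}$ with $|I|=|J|\ge|K|$, $\psi:I\to J$ is a bijection, $\pi:I\to K$ is a surjection, and $i<\pi(i)<\psi(i)$ for all $i\in I$. Indices in $I$, $J$, $K$ are called exceptional, penalty and fine; other indices of $\{2,\dots,n\}$ are ordinary. For $k\in K$ put $d(k)=\min\pi^{ -1}(k)$. For $2\le r\le n$, $\theta(r)=r-2$ if $r$ is ordinary, $r-1$ if exceptional, $\psi^{ -1}(r)-1$ if penalty, $d(r)-2$ if fine. A sequence $(x_i)_{i=0}^n$ of nonnegative reals is admissible for $\mathcal S$ if $x_r=x_{r-1}+x_{\theta(r)}$ for all $2\le r\le n$ and $0\le x_0\le x_1\le 2x_0$. -}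

module Defs where

open import Level using (Level)
open import Data.Empty using (⊥)
open import Data.Bool using (Bool; true; false; T)
open import Data.Nat using (ℕ; zero; suc; _+_; _∸_; _≤_; _<_)
open import Data.Product using (_×_; Σ; ∃)
open import Relation.Binary.PropositionalEquality using (_≡_)
open import Relation.Binary.Core using (Rel)
open import Relation.Nullary using (¬_)
open import Algebra.Bundles using (CommutativeSemiring)

-- Fibonacci with the paper's convention F(0) = F(1) = 1 (hence F(-1) = 0).
-- We index by m+1:  Fs m = F(m - 1), i.e. Fs 0 = F(-1) = 0, Fs 1 = F(0) = 1,
-- Fs (m+2) = Fs (m+1) + Fs m.  So F(m) = Fs (suc m).
Fs : ℕ → ℕ
Fs zero = zero
Fs (suc zero) = suc zero
Fs (suc (suc m)) = Fs (suc m) + Fs m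

-- A system S = (n, I, J, K, ψ, π).  Subsets of {2,…,n} are given by their
-- (Boolean) characteristic functions on ℕ; ψ and π are functions ℕ → ℕ
-- whose values matter only on I.
record System : Set where
  field
    n    : ℕ
    2≤n  : 2 ≤ n
    I J K : ℕ → Bool
    I⊆   : ∀ i → T (I i) → 2 ≤ i × i ≤ n
    J⊆   : ∀ i → T (J i) → 2 ≤ i × i ≤ n
    K⊆   : ∀ i → T (K i) → 2 ≤ i × i ≤ n
    I∩J  : ∀ i → T (I i) → T (J i) → ⊥
    I∩K  : ∀ i → T (I i) → T (K i) → ⊥
    J∩K  : ∀ i → T (J i) → T (K i) → ⊥
    ψ π  : ℕ → ℕ
    ψ-into : ∀ i → T (I i) → T (J (ψ i))
    ψ-inj  : ∀ i i′ → T (I i) → T (I i′) → ψ i ≡ ψ i′ → i ≡ i′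
    ψ-surj : ∀ j → T (J j) → Σ ℕ λ i → T (I i) × ψ i ≡ j
    π-into : ∀ i → T (I i) → T (K (π i))
    π-surj : ∀ k → T (K k) → Σ ℕ λ i → T (I i) × π i ≡ k
    π-bounds : ∀ i → T (I i) → i < π i × π i < ψ i
  -- (|I| = |J| ≥ |K| follows from ψ bijective and π surjective.)

  Ordinary : ℕ → Set
  Ordinary r = ¬ T (I r) × ¬ T (J r) × ¬ T (K r)

  IsD : ℕ → ℕ → Set
  IsD k d = T (I d) × π d ≡ k × (∀ i → T (I i) → π i ≡ k → d ≤ i)



module _ {c ℓ : Level} (R : CommutativeSemiring c ℓ)
         (_≤R_ : Rel (CommutativeSemiring.Carrier R) ℓ) where
  open CommutativeSemiring R renaming (_+_ to _⊕_)

  _·_ : ℕ → Carrier → Carrier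
  zero · x = 0#
  suc m · x = x ⊕ (m · x)

  -- Admissibility: x_r = x_{r-1} + x_{θ(r)} for 2 ≤ r ≤ n, each x_i ≥ 0,
  -- and 0 ≤ x_0 ≤ x_1 ≤ 2 x_0.  θ is spelled out case by case.
  record Admissible (S : System) (x : ℕ → Carrier) : Set (c Level.⊔ ℓ) where
    open System S
    field
      nonneg   : ∀ i → i ≤ n → 0# ≤R x i
      x₀≤x₁    : x 0 ≤R x 1
      x₁≤2x₀   : x 1 ≤R (x 0 ⊕ x 0)
      rec-ord  : ∀ r → 2 ≤ r → r ≤ n → Ordinary r →
                   x r ≈ x (r ∸ 1) ⊕ x (r ∸ 2)
      rec-exc  : ∀ r → 2 ≤ r → r ≤ n → T (I r) →
                   x r ≈ x (r ∸ 1) ⊕ x (r ∸ 1)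
      rec-pen  : ∀ r → 2 ≤ r → r ≤ n → T (J r) →
                   ∀ i → T (I i) → ψ i ≡ r →
                   x r ≈ x (r ∸ 1) ⊕ x (i ∸ 1)
      rec-fine : ∀ r → 2 ≤ r → r ≤ n → T (K r) →
                   ∀ d → IsD r d →
                   x r ≈ x (r ∸ 1) ⊕ x (d ∸ 2)

-- On a run of ordinary indices the admissibility relation is the Fibonacci
-- recurrence y r = y (r - 1) + y (r - 2).  Any sequence obeying that
-- recurrence on a window is, across the window, the combination of its two
-- starting values with Fibonacci coefficients, as one sees by two-step
-- induction using F(s + 2) = F(s + 1) + F(s).
module Submission where

open import Defs
open import Level using (Level)
open import Data.Nat using (ℕ; zero; suc; _+_; _∸_; _≤_; _<_; s≤s; z≤n)
open import Data.Nat.Properties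
  using (+-comm; ≤-trans; ≤-pred; ≤-reflexive; m≤n+m; +-monoˡ-≤; n<1+n; m<n⇒m<1+n)
open import Relation.Binary.PropositionalEquality using (cong)
open import Relation.Binary.Core using (Rel)
open import Algebra.Bundles using (CommutativeSemiring)
import Algebra.Properties.CommutativeSemigroup as CommutativeSemigroupProperties
import Relation.Binary.Reasoning.Setoid as SetoidReasoning

module FibonacciRecurrence {c ℓ : Level} (R : CommutativeSemiring c ℓ)
    (_≤R_ : Rel (CommutativeSemiring.Carrier R) ℓ) where
  open CommutativeSemiring R renaming (_+_ to _⊕_)
  open CommutativeSemigroupProperties +-commutativeSemigroup using (interchange)
  open SetoidReasoning setoid

  infixr 8 _·'_
  _·'_ : ℕ → Carrier → Carrier
  _·'_ = _·_ R _≤R_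

  ·-distribʳ-+ : ∀ p q x → (p + q) ·' x ≈ p ·' x ⊕ q ·' x
  ·-distribʳ-+ zero    q x = sym (+-identityˡ _)
  ·-distribʳ-+ (suc p) q x = begin
    x ⊕ (p + q) ·' x           ≈⟨ +-congˡ (·-distribʳ-+ p q x) ⟩
    x ⊕ (p ·' x ⊕ q ·' x)      ≈⟨ sym (+-assoc _ _ _) ⟩
    (x ⊕ p ·' x) ⊕ q ·' x      ∎

  FibonacciUpTo : ℕ → (ℕ → Carrier) → Set ℓ
  FibonacciUpTo t z = ∀ i → i < t → z (2 + i) ≈ z (1 + i) ⊕ z i

  FibonacciUpTo-pred : ∀ {t z} → FibonacciUpTo (suc t) z → FibonacciUpTo t z
  FibonacciUpTo-pred rec i i<t = rec i (m<n⇒m<1+n i<t)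

  fibonacci-closed-form : ∀ t z → FibonacciUpTo t z →
                          z (suc t) ≈ Fs (suc t) ·' z 1 ⊕ Fs t ·' z 0
  fibonacci-closed-form zero z rec = begin
    z 1                 ≈⟨ sym (+-identityʳ _) ⟩
    z 1 ⊕ 0#            ≈⟨ sym (+-identityʳ _) ⟩
    (z 1 ⊕ 0#) ⊕ 0#     ∎
  fibonacci-closed-form (suc zero) z rec = begin
    z 2                         ≈⟨ rec 0 (n<1+n 0) ⟩
    z 1 ⊕ z 0                   ≈⟨ sym (+-cong (+-identityʳ _) (+-identityʳ _)) ⟩
    (z 1 ⊕ 0#) ⊕ (z 0 ⊕ 0#)     ∎
  fibonacci-closed-form (suc (suc s)) z rec = begin
    z (3 + s)                                 ≈⟨ rec (suc s) (n<1+n _) ⟩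
    z (2 + s) ⊕ z (1 + s)                     ≈⟨ +-cong (fibonacci-closed-form (suc s) z rec₁)
                                                        (fibonacci-closed-form s z rec₀) ⟩
    (F₂ ·' a ⊕ F₁ ·' b) ⊕ (F₁ ·' a ⊕ F₀ ·' b) ≈⟨ interchange _ _ _ _ ⟩
    (F₂ ·' a ⊕ F₁ ·' a) ⊕ (F₁ ·' b ⊕ F₀ ·' b) ≈⟨ sym (+-cong (·-distribʳ-+ F₂ F₁ a) (·-distribʳ-+ F₁ F₀ b)) ⟩
    (F₂ + F₁) ·' a ⊕ (F₁ + F₀) ·' b           ∎
    where
    a = z 1
    b = z 0
    F₂ = Fs (suc (suc s))
    F₁ = Fs (suc s)
    F₀ = Fs s
    rec₁ = FibonacciUpTo-pred rec
    rec₀ = FibonacciUpTo-pred rec₁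

module _ {c ℓ : Level} {R : CommutativeSemiring c ℓ}
    {_≤R_ : Rel (CommutativeSemiring.Carrier R) ℓ}
    {S : System} {y : ℕ → CommutativeSemiring.Carrier R} where
  open System S using (n; Ordinary)
  open FibonacciRecurrence R _≤R_ using (FibonacciUpTo)

  -- With k = m + 2 the window is read from index k - 2 = m; writing i + m rather
  -- than m + i makes y (suc i + m) reduce to y (suc (i + m)).
  admissible-fibonacci-on-ordinary : Admissible R _≤R_ S y → ∀ m t →
    suc (suc m) + t ≤ suc n →
    (∀ j → suc (suc m) ≤ j → j < suc (suc m) + t → Ordinary j) →
    FibonacciUpTo t (λ i → y (i + m))
  admissible-fibonacci-on-ordinary adm m t k+t≤1+n ordinary i i<t =
    Admissible.rec-ord adm r (s≤s (s≤s z≤n)) (≤-pred (≤-trans r<k+t k+t≤1+n))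
                       (ordinary r k≤r r<k+t)
    where
    r = suc (suc (i + m))
    k≤r : suc (suc m) ≤ r
    k≤r = s≤s (s≤s (m≤n+m m i))
    r<k+t : r < suc (suc m) + t
    r<k+t = s≤s (s≤s (≤-trans (+-monoˡ-≤ m i<t) (≤-reflexive (+-comm t m))))

proposition4p4 : ∀ {c ℓ : Level} (R : CommutativeSemiring c ℓ)
                   (_≤R_ : Rel (CommutativeSemiring.Carrier R) ℓ)
                   (S : System) (y : ℕ → CommutativeSemiring.Carrier R) →
                   Admissible R _≤R_ S y →
                   (k t' : ℕ) → 2 ≤ k → k + t' ≤ suc (System.n S) →
                   (∀ j → k ≤ j → j < k + t' → System.Ordinary S j) →
                   CommutativeSemiring._≈_ R (y (k + t' ∸ 1))
                     (CommutativeSemiring._+_ R (_·_ R _≤R_ (Fs (suc t')) (y (k ∸ 1)))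
                                                (_·_ R _≤R_ (Fs t') (y (k ∸ 2))))
proposition4p4 R _≤R_ S y adm (suc (suc m)) t' (s≤s (s≤s _)) k+t≤1+n ordinary =
  trans (reflexive (cong (λ i → y (suc i)) (+-comm m t')))
        (fibonacci-closed-form t' (λ i → y (i + m))
          (admissible-fibonacci-on-ordinary adm m t' k+t≤1+n ordinary))
  where
  open CommutativeSemiring R using (trans; reflexive)
  open FibonacciRecurrence R _≤R_ using (fibonacci-closed-form)
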